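{- (1) For every generalized simplicial model $\mathcal C$, every world $w$ of $\mathcal C$ and every formula $\varphi\in\mathcal L_D$: $\mathcal C,w\models\varphi$ iff $\kappa(\mathcal C),w\models\varphi$. (2) For every partial epistemic model $M$ that is proper and has no empty world, every world $w$ of $M$ and every $\varphi\in\mathcal L_D$: $M,w\models\varphi$ iff $\sigma(M),X_w\models\varphi$.
   Context: Fix a finite set $A$ of agents and a countable set $\mathsf{AP}$ of atomic propositions. $\mathcal L_D$: $\varphi::=p\mid\neg\varphi\mid\varphi\wedge\varphi\mid D_B\varphi$, $p\in\mathsf{AP}$, $\emptyset\ne B\subseteq A$. A chromatic simplicial complex is $\langle V,S,\chi\rangle$ with $S$ a family of non-empty subsets of $V$ containing all singletons and closed under non-empty subsets, $\chi:V\to A$ injective on each simplex. A generalized simplicial model is $\mathcal C=\langle V,S,\chi,W,\ell\rangle$ with $\mathrm{Facets}\subseteq W\subseteq S$ and $\ell:W\to\mathcal P(\mathsf{AP})$; satisfaction: $\mathcal C,w\models p$ iff $p\in\ell(w)$, boolean clauses standard, $\mathcal C,w\models D_B\varphi$ iff $\mathcal C,w'\models\varphi$ for every $w'\in W$ with $B\subseteq\chi(w\cap w')$. A partial epistemic model is $M=\langle W,\sim,L\rangle$ with each $\sim_a$ a symmetric transitive relation on $W$ and $L:W\to\mathcal P(\mathsf{AP})$; $M,w\models p$ iff $p\in L(w)$, boolean clauses standard, $M,w\models D_B\varphi$ iff $M,w'\models\varphi$ for all $w'$ with $w\sim_a w'$ for every $a\in B$. $\mathrm{live}(w)=\{a:w\sim_a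 w\}$; no empty world: $\mathrm{live}(w)\ne\emptyset$ for all $w$; proper: for $w\neq w'$ with $\mathrm{live}(w)=\mathrm{live}(w')$ there is $a\in\mathrm{live}(w)$ with $w\not\sim_a w'$. $\kappa(\mathcal C)=\langle W,\sim,L\rangle$: same worlds, $w\sim_a w'$ iff $a\in\chi(w\cap w')$, $L=\ell$. $\sigma(M)$: with $[w]_a$ the $\sim_a$-class of $w$ for $a\in\mathrm{live}(w)$, vertices $v^w_a=(a,[w]_a)$; simplices are the sets $X_w=\{v^w_a: a\in\mathrm{live}(w)\}$ ($w\in W$) and their non-empty subsets; $\chi(v^w_a)=a$; worlds $\{X_w:w\in W\}$; labelling $\ell(X_w)=L(w)$. -}

module Defs where

open import Data.Nat using (ℕ)
open import Level using (0ℓ)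
open import Data.Fin using (Fin)
open import Data.Fin.Subset using (Subset; _∈_; Nonempty)
open import Data.Product using (Σ; ∃; _×_; _,_; proj₁; proj₂)
open import Data.Empty using (⊥)
open import Relation.Nullary using (¬_)
open import Relation.Unary using (Pred; _⊆_; _≐_)
open import Relation.Binary using (IsEquivalence)
open import Relation.Binary.PropositionalEquality as P using (_≡_; _≢_; refl)

data Formula (n : ℕ) : Set where
  atom : ℕ → Formula n
  ¬′_  : Formula n → Formula n
  _∧′_ : Formula n → Formula n → Formula n
  D    : (B : Subset n) → Nonempty B → Formula n → Formula n

-- Since σ(M) needs vertices that are
-- equivalence classes (a , [w]_a), the vertex set is a setoid (V , _≈_);
-- subsets of V are predicates respecting _≈_.  An ordinary set is the
-- case _≈_ = _≡_.

record ChromaticComplex (n : ℕ) : Set₁ where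
  field
    V       : Set
    _≈_     : V → V → Set
    ≈-equiv : IsEquivalence _≈_
    χ       : V → Fin n
    χ-resp  : ∀ {u v} → u ≈ v → χ u ≡ χ v
    S           : Pred V 0ℓ → Set
    S-resp      : ∀ {X} → S X → ∀ {u v} → u ≈ v → X u → X v
    S-nonempty  : ∀ {X} → S X → ∃ λ v → X v
    S-singleton : ∀ v → S (λ u → u ≈ v)
    S-down      : ∀ {X Y} → S X → Y ⊆ X → (∀ {u v} → u ≈ v → Y u → Y v) →
                  (∃ λ v → Y v) → S Y
    S-chromatic : ∀ {X} → S X → ∀ {u v} → X u → X v → χ u ≡ χ v → u ≈ v

  IsFacet : Pred V 0ℓ → Set₁
  IsFacet X = S X × (∀ Y → S Y → X ⊆ Y → Y ⊆ X)

  _∈χ[_∩_] : Fin n → Pred V 0ℓ → Pred V 0ℓ → Set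
  a ∈χ[ X ∩ Y ] = ∃ λ v → X v × Y v × χ v ≡ a

-- The set of worlds W ⊆ S is given as a
-- type W with an embedding ⌊_⌋ into S (distinct worlds are distinct
-- simplices), containing (up to set equality) every facet.

record GSM (n : ℕ) : Set₁ where
  field
    complex : ChromaticComplex n
  open ChromaticComplex complex public
  field
    W          : Set
    ⌊_⌋        : W → Pred V 0ℓ
    W⊆S        : ∀ w → S ⌊ w ⌋
    W-distinct : ∀ w w′ → w ≢ w′ → ¬ (⌊ w ⌋ ≐ ⌊ w′ ⌋)
    facets⊆W   : ∀ X → IsFacet X → ∃ λ w → X ≐ ⌊ w ⌋
    ℓ          : W → Pred ℕ 0ℓ

_,_⊨ₛ_ : ∀ {n} (C : GSM n) → GSM.W C → Formula n → Set
C , w ⊨ₛ atom p = GSM.ℓ C w p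
C , w ⊨ₛ (¬′ φ) = ¬ (C , w ⊨ₛ φ)
C , w ⊨ₛ (φ ∧′ ψ) = (C , w ⊨ₛ φ) × (C , w ⊨ₛ ψ)
C , w ⊨ₛ D B _ φ = ∀ w′ →
  (∀ a → a ∈ B → GSM._∈χ[_∩_] C a (GSM.⌊_⌋ C w) (GSM.⌊_⌋ C w′)) →
  C , w′ ⊨ₛ φ

record PEM (n : ℕ) : Set₁ where
  field
    W      : Set
    R      : Fin n → W → W → Set
    R-sym  : ∀ {a w w′} → R a w w′ → R a w′ w
    R-trans : ∀ {a w w′ w″} → R a w w′ → R a w′ w″ → R a w w″
    L      : W → Pred ℕ 0ℓ

  live : W → Pred (Fin n) 0ℓ
  live w a = R a w w

NoEmptyWorld : ∀ {n} → PEM n → Set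
NoEmptyWorld M = ∀ w → ∃ λ a → live w a
  where open PEM M

Proper : ∀ {n} → PEM n → Set
Proper M = ∀ w w′ → w ≢ w′ → live w ≐ live w′ →
           ∃ λ a → live w a × ¬ R a w w′
  where open PEM M

_,_⊨ₑ_ : ∀ {n} (M : PEM n) → PEM.W M → Formula n → Set
M , w ⊨ₑ atom p = PEM.L M w p
M , w ⊨ₑ (¬′ φ) = ¬ (M , w ⊨ₑ φ)
M , w ⊨ₑ (φ ∧′ ψ) = (M , w ⊨ₑ φ) × (M , w ⊨ₑ ψ)
M , w ⊨ₑ D B _ φ = ∀ w′ → (∀ a → a ∈ B → PEM.R M a w w′) → M , w′ ⊨ₑ φ

κ : ∀ {n} → GSM n → PEM n
κ {n} C = record
  { W = W
  ; R = λ a w w′ → a ∈χ[ ⌊ w ⌋ ∩ ⌊ w′ ⌋ ]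
  ; R-sym = λ { (v , x , y , e) → v , y , x , e }
  ; R-trans = tr
  ; L = ℓ
  }
  where
  open GSM C
  tr : ∀ {a w w′ w″} → a ∈χ[ ⌊ w ⌋ ∩ ⌊ w′ ⌋ ] → a ∈χ[ ⌊ w′ ⌋ ∩ ⌊ w″ ⌋ ] →
       a ∈χ[ ⌊ w ⌋ ∩ ⌊ w″ ⌋ ]
  tr {w′ = w′} {w″} (v , x , y , e) (u , y′ , z , e′) =
    v , x , S-resp (W⊆S w″) u≈v z , e
    where u≈v = S-chromatic (W⊆S w′) y′ y (P.trans e′ (P.sym e))

-- σ(M).  Vertex v^w_a = (a , [w]_a) is represented by (a , w , a∈live(w))
-- with (a , w , _) ≈ (a′ , w′ , _)  iff  a ≡ a′ and w ∼_a w′.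

module Sigma {n : ℕ} (M : PEM n) where
  open PEM M

  record Vtx : Set where
    constructor vtx
    field
      col : Fin n
      wld : W
      lv  : live wld col
  open Vtx

  _≈_ : Vtx → Vtx → Set
  u ≈ v = col u ≡ col v × R (col u) (wld u) (wld v)

  ≈-sym : ∀ {u v} → u ≈ v → v ≈ u
  ≈-sym (refl , r) = refl , R-sym r

  ≈-trans : ∀ {u v t} → u ≈ v → v ≈ t → u ≈ t
  ≈-trans (refl , r) (refl , r′) = refl , R-trans r r′

  ≈-equiv : IsEquivalence _≈_
  ≈-equiv = record { refl = λ {u} → refl , lv u ; sym = λ {u} {v} → ≈-sym {u} {v} ; trans = λ {u} {v} {t} → ≈-trans {u} {v} {t} }

  -- X_w = { v^w_a : a ∈ live(w) }
  X : W → Pred Vtx 0ℓ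
  X w u = R (col u) w (wld u)

  X-resp : ∀ w {u v} → u ≈ v → X w u → X w v
  X-resp w (refl , r) x = R-trans x r

  Simp : Pred Vtx 0ℓ → Set
  Simp Y = (∀ {u v} → u ≈ v → Y u → Y v) × (∃ λ v → Y v) × (∃ λ w → Y ⊆ X w)

  complex : ChromaticComplex n
  complex = record
    { V = Vtx ; _≈_ = _≈_ ; ≈-equiv = ≈-equiv ; χ = col ; χ-resp = proj₁
    ; S = Simp
    ; S-resp = proj₁
    ; S-nonempty = λ s → proj₁ (proj₂ s)
    ; S-singleton = λ v →
        (λ {u} {u′} p q → ≈-trans {u′} {u} {v} (≈-sym {u} {u′} p) q)
      , (v , refl , lv v)
      , (wld v , λ { (refl , r) → R-sym r })
    ; S-down = λ { (_ , _ , w , Y⊆) Z⊆Y rz nz → rz , nz , w , λ z → Y⊆ (Z⊆Y z) }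
    ; S-chromatic = chrom
    }
    where
    chrom : ∀ {Y} → Simp Y → ∀ {u v} → Y u → Y v → col u ≡ col v → u ≈ v
    chrom (_ , _ , w , Y⊆) yu yv refl = refl , R-trans (R-sym (Y⊆ yu)) (Y⊆ yv)

  module _ (ne : NoEmptyWorld M) (pr : Proper M) where

    X-simp : ∀ w → Simp (X w)
    X-simp w with ne w
    ... | a , r = (λ {u} {v} → X-resp w {u} {v}) , (vtx a w r , r) , (w , λ {x} p → p)

    distinct : ∀ w w′ → w ≢ w′ → ¬ (X w ≐ X w′)
    distinct w w′ neq (f , g) with pr w w′ neq
      ((λ {a} r → R-trans (f {vtx a w r} r) (R-sym (f {vtx a w r} r)))
      , (λ {a} r → R-trans (g {vtx a w′ r} r) (R-sym (g {vtx a w′ r} r))))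
    ... | a , r , nr = nr (R-sym (f {vtx a w r} r))

    σ : GSM n
    σ = record
      { complex = complex
      ; W = W
      ; ⌊_⌋ = X
      ; W⊆S = X-simp
      ; W-distinct = distinct
      ; facets⊆W = λ { Y ((_ , _ , w , Y⊆) , mx) → w , Y⊆ , mx (X w) (X-simp w) Y⊆ }
      ; ℓ = L
      }

σ : ∀ {n} (M : PEM n) → NoEmptyWorld M → Proper M → GSM n
σ M = Sigma.σ M

{-# OPTIONS --safe #-}
module Submission where

open import Defs
open import Data.Fin using (Fin)
open import Data.Fin.Subset using (Subset; _∈_)
open import Data.Product using (_×_; _,_)
open import Data.Product.Function.NonDependent.Propositional using (_×-⇔_)
open import Function.Bundles using (_⇔_; mk⇔; Equivalence)
open import Function.Properties.Equivalence as ⇔ using ()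
open import Function.Related.TypeIsomorphisms using (¬-cong-⇔)
open import Relation.Binary.PropositionalEquality using (refl)

-- Both semantics are Kripke semantics for distributed knowledge over the same
-- worlds and valuation; they agree as soon as the accessibility relations do.
-- In κ(C) the relation is a ∈ χ(w ∩ w′) by definition, and in σ(M) the shared
-- a-vertex of X_w and X_w′ is exactly the class [w]_a = [w′]_a.

∀∈-cong-⇔ : ∀ {n} {P Q : Fin n → Set} (B : Subset n) →
            (∀ a → P a ⇔ Q a) → (∀ a → a ∈ B → P a) ⇔ (∀ a → a ∈ B → Q a)
∀∈-cong-⇔ B P⇔Q = mk⇔ (λ f a i → Equivalence.to (P⇔Q a) (f a i))
                      (λ f a i → Equivalence.from (P⇔Q a) (f a i))

module _ {n} (C : GSM n) where
  open GSM C

  module _ {R : Fin n → W → W → Set}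
           (R-sym : ∀ {a w w′} → R a w w′ → R a w′ w)
           (R-trans : ∀ {a w w′ w″} → R a w w′ → R a w′ w″ → R a w w″)
           (∈χ⇔R : ∀ a w w′ → a ∈χ[ ⌊ w ⌋ ∩ ⌊ w′ ⌋ ] ⇔ R a w w′) where

    -- With R the relation of κ(C) this is κ(C); for C = σ(M) it is M, by record η.
    onWorlds : PEM n
    onWorlds = record { W = W ; R = R ; R-sym = R-sym ; R-trans = R-trans ; L = ℓ }

    ⊨ₛ⇔⊨ₑ : ∀ w φ → (C , w ⊨ₛ φ) ⇔ (onWorlds , w ⊨ₑ φ)
    ⊨ₛ⇔⊨ₑ w (atom p)   = ⇔.refl
    ⊨ₛ⇔⊨ₑ w (¬′ φ)     = ¬-cong-⇔ (⊨ₛ⇔⊨ₑ w φ)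
    ⊨ₛ⇔⊨ₑ w (φ ∧′ ψ)   = ⊨ₛ⇔⊨ₑ w φ ×-⇔ ⊨ₛ⇔⊨ₑ w ψ
    ⊨ₛ⇔⊨ₑ w (D B _ φ) = mk⇔
      (λ f w′ r → Equivalence.to (⊨ₛ⇔⊨ₑ w′ φ) (f w′ (Equivalence.from (accessible w′) r)))
      (λ f w′ r → Equivalence.from (⊨ₛ⇔⊨ₑ w′ φ) (f w′ (Equivalence.to (accessible w′) r)))
      where
      accessible : ∀ w′ → (∀ a → a ∈ B → a ∈χ[ ⌊ w ⌋ ∩ ⌊ w′ ⌋ ]) ⇔ (∀ a → a ∈ B → R a w w′)
      accessible w′ = ∀∈-cong-⇔ B (λ a → ∈χ⇔R a w w′)

κ-preserves-⊨ : ∀ {n} (C : GSM n) w φ → (C , w ⊨ₛ φ) ⇔ (κ C , w ⊨ₑ φ)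
κ-preserves-⊨ C = ⊨ₛ⇔⊨ₑ C (PEM.R-sym (κ C)) (PEM.R-trans (κ C)) (λ _ _ _ → ⇔.refl)

module _ {n} (M : PEM n) (ne : NoEmptyWorld M) (pr : Proper M) where
  open PEM M
  open GSM (σ M ne pr) using (_∈χ[_∩_]; ⌊_⌋)
  open Sigma M using (vtx)

  σ-∈χ⇔R : ∀ a w w′ → a ∈χ[ ⌊ w ⌋ ∩ ⌊ w′ ⌋ ] ⇔ R a w w′
  σ-∈χ⇔R a w w′ = mk⇔
    (λ { (vtx _ _ _ , w∼v , w′∼v , refl) → R-trans w∼v (R-sym w′∼v) })
    (λ w∼w′ → let w′-live = R-trans (R-sym w∼w′) w∼w′
              in vtx a w′ w′-live , w∼w′ , w′-live , refl)

  σ-preserves-⊨ : ∀ w φ → (M , w ⊨ₑ φ) ⇔ (σ M ne pr , w ⊨ₛ φ)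
  σ-preserves-⊨ w φ = ⇔.sym (⊨ₛ⇔⊨ₑ (σ M ne pr) R-sym R-trans σ-∈χ⇔R w φ)

theorem31 : ∀ {n} →
    ((C : GSM n) (w : GSM.W C) (φ : Formula n) →
    (C , w ⊨ₛ φ) ⇔ (κ C , w ⊨ₑ φ))
    ×
    ((M : PEM n) (ne : NoEmptyWorld M) (pr : Proper M) (w : PEM.W M) (φ : Formula n) →
    (M , w ⊨ₑ φ) ⇔ (σ M ne pr , w ⊨ₛ φ))
theorem31 = κ-preserves-⊨ , σ-preserves-⊨
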